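{- Let $d\ge1$, let $\mathcal D\subset\mathbb N^d$ be a finite down-set with respect to $\preceq$, and let $A\subseteq\mathcal D$, $B\subseteq\mathbb N^d$. Suppose that for every $\mathbf b=(b_1,\dots,b_d)\in B$ there are subsets $R_{l;n_{l+1},\dots,n_d;\mathbf b}\subseteq\mathbb N$ (for $1\le l\le d$ and $n_{l+1},\dots,n_d\in\mathbb N$) with the following properties: (1) for every $1\le l\le d$ and every $n_d\in\mathbb N\setminus R_{d;\mathbf b}$, $n_{d-1}\in\mathbb N\setminus R_{d-1;n_d;\mathbf b}$, …, $n_{l+1}\in\mathbb N\setminus R_{l+1;n_{l+2},\dots,n_d;\mathbf b}$, we have $|R_{l;n_{l+1},\dots,n_d;\mathbf b}|\le b_l$; (2) if $\mathbf a=(a_1,\dots,a_d)\in A$ satisfies $a_d\notin R_{d;\mathbf b}$, $a_{d-1}\notin R_{d-1;a_d;\mathbf b}$, …, $a_2\notin R_{2;a_3,\dots,a_d;\mathbf b}$, then $a_1\in R_{1;a_2,\dots,a_d;\mathbf b}$. Then $|A|\le|\mathcal D\setminus{\uparrow}B|$.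
   Context: $\mathbb N=\{0,1,\dots\}$; $\preceq$ is the product order on $\mathbb N^d$ ($\mathbf a\preceq\mathbf b$ iff $a_i\le b_i$ for all $i$). A down-set $\mathcal D$: $\mathbf p\preceq\mathbf d\in\mathcal D\Rightarrow\mathbf p\in\mathcal D$. ${\uparrow}B:=\{\mathbf p\in\mathbb N^d:\exists\mathbf b\in B,\ \mathbf b\preceq\mathbf p\}$. -}

module Defs where

open import Data.Nat using (ℕ; suc; _≤_; _<_)
open import Data.Fin using (Fin; toℕ)
open import Data.Vec using (Vec; lookup; toList)
open import Data.List using (List; drop; length)
open import Data.List.Membership.Propositional using (_∈_)
open import Data.Product using (Σ; _×_; ∃-syntax)
open import Relation.Nullary using (¬_)

-- Points of ℕ^d.  Coordinate x_l (1 ≤ l ≤ d, paper indexing) is  lookup p i  with  toℕ i = l - 1.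
Point : ℕ → Set
Point d = Vec ℕ d

_⪯_ : ∀ {d} → Point d → Point d → Set
p ⪯ q = ∀ i → lookup p i ≤ lookup q i

IsDownSet : ∀ {d} → List (Point d) → Set
IsDownSet {d} D = ∀ (p q : Point d) → p ⪯ q → q ∈ D → p ∈ D

↑ : ∀ {d} → (Point d → Set) → Point d → Set
↑ {d} B p = ∃[ b ] (B b × b ⪯ p)

-- for the coordinate with (0-based) index i, i.e. paper's l = toℕ i + 1,
-- the tuple (n_{l+1}, …, n_d) of the later coordinates of n
tailAfter : ∀ {d} → Fin d → Point d → List ℕ
tailAfter i n = drop (suc (toℕ i)) (toList n)

CardLe : (ℕ → Set) → ℕ → Set
CardLe S k = Σ (List ℕ) λ xs → (length xs ≤ k) × (∀ x → S x → x ∈ xs)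

-- Family R_{l; n_{l+1},…,n_d} (for fixed b): R (n_{l+1} ∷ … ∷ n_d ∷ []) is the subset of ℕ
-- (the level l is determined by the length d - l of the list).
Family : Set₁
Family = List ℕ → ℕ → Set

AvoidsAbove : ∀ {d} → Family → Fin d → Point d → Set
AvoidsAbove {d} R i n = ∀ (j : Fin d) → toℕ i < toℕ j → ¬ R (tailAfter j n) (lookup n j)

Prop1 : ∀ {d} → Point d → Family → Set
Prop1 {d} b R = ∀ (i : Fin d) (n : Point d) → AvoidsAbove R i n →
  CardLe (R (tailAfter i n)) (lookup b i)

-- property (2) for b  (i₀ = coordinate 1)
Prop2 : ∀ {d} → List (Point d) → Point d → Family → Fin d → Set
Prop2 {d} A b R i₀ = ∀ a → a ∈ A → AvoidsAbove R i₀ a → R (tailAfter i₀ a) (lookup a i₀)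

module Submission where

-- Count points in a box [0, M)^d containing D, by induction on d, slicing along the last
-- coordinate t.  A point b of B with t ∉ R_{d;b} yields, for the slice A_t = {a : (a, t) ∈ A},
-- the point (b_1, …, b_{d-1}) with the sets R_{l; …, t; b}, which satisfy (1) and (2) again;
-- so |A_t| ≤ |D_t ∖ ↑B_t| by induction.  Summing over t and exchanging the sums, it remains to
-- compare, for each p ∈ ℕ^{d-1}, the t with (p, t) ∈ D and t ∈ R_{d;b} for every b with
-- (b_1, …, b_{d-1}) ⪯ p against the t with (p, t) ∈ D and t < b_d for all those b, which are the
-- points of D ∖ ↑B above p.  The column of D over p is an initial segment and |R_{d;b}| ≤ b_d,
-- so the b with least b_d shows that the first number is at most the second.

open import Defs
open import Level using (Level; 0ℓ) renaming (suc to lsuc)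
open import Algebra.Properties.CommutativeSemigroup using (interchange)
open import Data.Bool using (if_then_else_)
open import Data.Nat using (ℕ; zero; suc; _+_; _⊔_; _≤_; _<_; z≤n; s≤s⁻¹; _≟_; _<?_; _≤?_)
open import Data.Nat.Properties
open import Data.Fin using (Fin; zero; suc; inject₁; fromℕ)
open import Data.Fin.Properties using (toℕ-inject₁; ≤fromℕ) renaming (all? to allFin?)
open import Data.Fin.Relation.Unary.Top using (view; ‵fromℕ; ‵inject₁)
open import Data.Vec using (Vec; []; _∷_; _∷ʳ_; lookup; init; last; initLast)
open import Data.Vec.Properties using (toList-∷ʳ; ≡-dec; ∷ʳ-injective)
open import Data.List using (List; []; _∷_; length; _++_; [_]; filter)
open import Data.List.Relation.Unary.All as All using (All; []; _∷_; all?)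
open import Data.List.Relation.Unary.Any as Any using (Any; here; there; any?; satisfied)
open import Data.List.Relation.Unary.All.Properties using (All¬⇒¬Any)
open import Data.List.Relation.Unary.AllPairs using (_∷_)
open import Data.List.Relation.Unary.Unique.Propositional using (Unique)
open import Data.List.Membership.Propositional using (_∈_; _∉_; find)
open import Data.List.Membership.Propositional.Properties using (∈-filter⁺; ∈-filter⁻)
open import Data.List.Membership.DecPropositional _≟_ using (_∈?_)
open import Data.List.Extrema.Nat using (argmin; argmin-all; f[argmin]≤f[⊤]; f[argmin]≤f[xs])
open import Data.Product using (Σ; _×_; _,_; proj₁; proj₂; ∃-syntax)
open import Data.Sum using (_⊎_; inj₁; inj₂)
open import Relation.Binary.Definitions using (DecidableEquality) renaming (Decidable to Decidable₂)
open import Relation.Binary.PropositionalEquality using (_≡_; refl; sym; trans; cong; cong₂; subst; subst₂; module ≡-Reasoning)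
open import Relation.Nullary using (Dec; yes; no; ¬_; ¬?; _×-dec_; does; contradiction)
open import Relation.Nullary.Decidable using (decidable-stable; ¬¬-excluded-middle)
open import Relation.Nullary.Negation using (¬¬-map; ¬¬-Monad)
open import Effect.Monad using (RawMonad)
open import Function using (_∘_)
open import Function.Bundles using (_⇔_; Equivalence)
open import Relation.Unary using (Pred; Decidable; _⊆_)
open import Relation.Unary.Properties using (_∩?_; ∁?)

private
  variable
    ℓ : Level

∑< : ℕ → (ℕ → ℕ) → ℕ
∑< zero f = 0
∑< (suc M) f = ∑< M f + f M

∑<-cong : ∀ M {f g : ℕ → ℕ} → (∀ t → f t ≡ g t) → ∑< M f ≡ ∑< M g
∑<-cong zero f≗g = refl
∑<-cong (suc M) f≗g = cong₂ _+_ (∑<-cong M f≗g) (f≗g M)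

∑<-mono : ∀ M {f g : ℕ → ℕ} → (∀ t → f t ≤ g t) → ∑< M f ≤ ∑< M g
∑<-mono zero f≤g = z≤n
∑<-mono (suc M) f≤g = +-mono-≤ (∑<-mono M f≤g) (f≤g M)

∑<-zero : ∀ M → ∑< M (λ _ → 0) ≡ 0
∑<-zero zero = refl
∑<-zero (suc M) = trans (+-identityʳ _) (∑<-zero M)

∑<-distrib-+ : ∀ M (f g : ℕ → ℕ) → ∑< M (λ t → f t + g t) ≡ ∑< M f + ∑< M g
∑<-distrib-+ zero f g = refl
∑<-distrib-+ (suc M) f g = trans (cong (_+ (f M + g M)) (∑<-distrib-+ M f g))
  (interchange +-commutativeSemigroup (∑< M f) (∑< M g) (f M) (g M))

∑<-comm : ∀ M N (h : ℕ → ℕ → ℕ) → ∑< M (λ s → ∑< N (h s)) ≡ ∑< N (λ t → ∑< M (λ s → h s t))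
∑<-comm zero N h = sym (∑<-zero N)
∑<-comm (suc M) N h = trans (cong (_+ ∑< N (h M)) (∑<-comm M N h))
  (sym (∑<-distrib-+ N (λ t → ∑< M (λ s → h s t)) (h M)))

-- Defined through `does`, so that χ of an `any?` decision unfolds once its head is decided.
χ : ∀ {P : Set ℓ} → Dec P → ℕ
χ P? = if does P? then 1 else 0

χ-mono : ∀ {ℓ′} {P : Set ℓ} {Q : Set ℓ′} → (P → Q) → (P? : Dec P) (Q? : Dec Q) → χ P? ≤ χ Q?
χ-mono P⇒Q (yes p) (yes q) = ≤-refl
χ-mono P⇒Q (yes p) (no ¬q) = contradiction (P⇒Q p) ¬q
χ-mono P⇒Q (no ¬p) Q? = z≤n

χ-cong : ∀ {ℓ′} {P : Set ℓ} {Q : Set ℓ′} → (P → Q) → (Q → P) → (P? : Dec P) (Q? : Dec Q) → χ P? ≡ χ Q?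
χ-cong P⇒Q Q⇒P P? Q? = ≤-antisym (χ-mono P⇒Q P? Q?) (χ-mono Q⇒P Q? P?)

χ-yes : ∀ {P : Set ℓ} → P → (P? : Dec P) → χ P? ≡ 1
χ-yes p (yes _) = refl
χ-yes p (no ¬p) = contradiction p ¬p

χ-no : ∀ {P : Set ℓ} → ¬ P → (P? : Dec P) → χ P? ≡ 0
χ-no ¬p (yes p) = contradiction p ¬p
χ-no ¬p (no _) = refl

module _ {a} {A : Set a} (_≟ᴬ_ : DecidableEquality A) where

  χ-any-∷ : ∀ y x xs → χ (any? (y ≟ᴬ_) (x ∷ xs)) ≤ χ (y ≟ᴬ x) + χ (any? (y ≟ᴬ_) xs)
  χ-any-∷ y x xs with y ≟ᴬ x
  ... | yes _ = m≤m+n 1 _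
  ... | no _ = ≤-refl

  χ-any-∷-∉ : ∀ y {x xs} → x ∉ xs → χ (any? (y ≟ᴬ_) (x ∷ xs)) ≡ χ (y ≟ᴬ x) + χ (any? (y ≟ᴬ_) xs)
  χ-any-∷-∉ y {x} {xs} x∉xs with y ≟ᴬ x
  ... | yes refl = cong suc (sym (χ-no x∉xs (any? (y ≟ᴬ_) xs)))
  ... | no _ = refl

count : ∀ {P : Pred ℕ ℓ} → ℕ → Decidable P → ℕ
count M P? = ∑< M (λ t → χ (P? t))

count-mono : ∀ {ℓ′} {P : Pred ℕ ℓ} {Q : Pred ℕ ℓ′} M (P? : Decidable P) (Q? : Decidable Q) →
  P ⊆ Q → count M P? ≤ count M Q?
count-mono M P? Q? P⊆Q = ∑<-mono M (λ t → χ-mono P⊆Q (P? t) (Q? t))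

count-≟≡0 : ∀ M x → M ≤ x → count M (_≟ x) ≡ 0
count-≟≡0 zero x _ = refl
count-≟≡0 (suc M) x M<x = cong₂ _+_ (count-≟≡0 M x (<⇒≤ M<x)) (χ-no (<⇒≢ M<x) (M ≟ x))

count-≟≡1 : ∀ M x → x < M → count M (_≟ x) ≡ 1
count-≟≡1 (suc M) x x<1+M with m≤n⇒m<n∨m≡n (s≤s⁻¹ x<1+M)
... | inj₁ x<M = cong₂ _+_ (count-≟≡1 M x x<M) (χ-no (>⇒≢ x<M) (M ≟ x))
... | inj₂ refl = cong₂ _+_ (count-≟≡0 M M ≤-refl) (χ-yes refl (M ≟ M))

count-≟≤1 : ∀ M x → count M (_≟ x) ≤ 1
count-≟≤1 M x with x <? M
... | yes x<M = ≤-reflexive (count-≟≡1 M x x<M)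
... | no x≮M = ≤-trans (≤-reflexive (count-≟≡0 M x (≮⇒≥ x≮M))) z≤n

count-∈≤length : ∀ M xs → count M (_∈? xs) ≤ length xs
count-∈≤length M [] = ≤-reflexive (∑<-zero M)
count-∈≤length M (x ∷ xs) = begin
  count M (_∈? x ∷ xs)                          ≤⟨ ∑<-mono M (λ t → χ-any-∷ _≟_ t x xs) ⟩
  ∑< M (λ t → χ (t ≟ x) + χ (t ∈? xs))          ≡⟨ ∑<-distrib-+ M _ _ ⟩
  count M (_≟ x) + count M (_∈? xs)              ≤⟨ +-mono-≤ (count-≟≤1 M x) (count-∈≤length M xs) ⟩
  suc (length xs)                                ∎
  where open ≤-Reasoning

count-⊆≤length : ∀ {P : Pred ℕ ℓ} M (P? : Decidable P) xs → P ⊆ (_∈ xs) → count M P? ≤ length xs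
count-⊆≤length M P? xs P⊆xs = ≤-trans (count-mono M P? (_∈? xs) P⊆xs) (count-∈≤length M xs)

count-≥ : ∀ {P : Pred ℕ ℓ} M (P? : Decidable P) {k} → k ≤ M → (∀ t → t < k → P t) → k ≤ count M P?
count-≥ zero P? z≤n _ = z≤n
count-≥ (suc M) P? k≤1+M P<k with m≤n⇒m<n∨m≡n k≤1+M
... | inj₁ k<1+M = ≤-trans (count-≥ M P? (s≤s⁻¹ k<1+M) P<k) (m≤m+n _ _)
... | inj₂ refl = begin
  suc M                   ≡⟨ +-comm 1 M ⟩
  M + 1                   ≤⟨ +-mono-≤ (count-≥ M P? ≤-refl (λ t t<M → P<k t (m<n⇒m<1+n t<M)))
                                      (≤-reflexive (sym (χ-yes (P<k M ≤-refl) (P? M)))) ⟩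
  count (suc M) P?        ∎
  where open ≤-Reasoning

module Column {C : Pred ℕ ℓ} (C? : Decidable C) (C-down : ∀ {s t} → s ≤ t → C t → C s) where

  count-∈≤count-< : ∀ M {S : List ℕ} {β} → length S ≤ β → count M (C? ∩? (_∈? S)) ≤ count M (C? ∩? (_<? β))
  count-∈≤count-< zero |S|≤β = z≤n
  count-∈≤count-< (suc M) {S} {β} |S|≤β = step (L? M) (R? M)
    where
    L? : Decidable (λ t → C t × t ∈ S)
    L? = C? ∩? (_∈? S)
    R? : Decidable (λ t → C t × t < β)
    R? = C? ∩? (_<? β)
    open ≤-Reasoning
    step : (l : Dec (C M × M ∈ S)) (r : Dec (C M × M < β)) → count M L? + χ l ≤ count M R? + χ r
    step (no _) r = +-mono-≤ (count-∈≤count-< M {S} |S|≤β) z≤n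
    step (yes _) (yes _) = +-mono-≤ (count-∈≤count-< M {S} |S|≤β) ≤-refl
    -- Here β ≤ M: everything counted on the left lies in S, while all of [0, β) ⊆ C is counted on the right.
    step (yes (cM , M∈S)) (no ¬[cM×M<β]) = begin
      count M L? + 1   ≡⟨ cong (count M L? +_) (χ-yes (cM , M∈S) (L? M)) ⟨
      count (suc M) L? ≤⟨ count-⊆≤length (suc M) L? S proj₂ ⟩
      length S         ≤⟨ |S|≤β ⟩
      β                ≤⟨ count-≥ M R? β≤M (λ t t<β → C-down (<⇒≤ (<-≤-trans t<β β≤M)) cM , t<β) ⟩
      count M R?       ≤⟨ m≤m+n _ 0 ⟩
      count M R? + 0   ∎
      where
      β≤M : β ≤ M
      β≤M = ≮⇒≥ (λ M<β → ¬[cM×M<β] (cM , M<β))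

  count-All∈≤count-All< : ∀ {e} {E : Set e} M (cover : E → List ℕ) (bound : E → ℕ) →
    (∀ x → length (cover x) ≤ bound x) → (es : List E) →
    count M (C? ∩? (λ t → all? (λ x → t ∈? cover x) es)) ≤ count M (C? ∩? (λ t → all? (λ x → t <? bound x) es))
  count-All∈≤count-All< M cover bound cover≤bound [] = ≤-refl
  count-All∈≤count-All< {E = E} M cover bound cover≤bound (e ∷ es) = begin
    count M All∈?
      ≤⟨ count-mono M All∈? (C? ∩? (_∈? cover m)) (λ (ct , t∈all) → ct , ∈cover-m t∈all) ⟩
    count M (C? ∩? (_∈? cover m))
      ≤⟨ count-∈≤count-< M {cover m} (cover≤bound m) ⟩
    count M (C? ∩? (_<? bound m))
      ≤⟨ count-mono M (C? ∩? (_<? bound m)) All<? (λ (ct , t<m) → ct , <bound-m t<m) ⟩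
    count M All<?
      ∎
    where
    open ≤-Reasoning
    -- Only the element of least bound constrains the right-hand side.
    m : E
    m = argmin bound e es
    All∈? : Decidable (λ t → C t × All (λ x → t ∈ cover x) (e ∷ es))
    All∈? = C? ∩? (λ t → all? (λ x → t ∈? cover x) (e ∷ es))
    All<? : Decidable (λ t → C t × All (λ x → t < bound x) (e ∷ es))
    All<? = C? ∩? (λ t → all? (λ x → t <? bound x) (e ∷ es))
    ∈cover-m : ∀ {t} → All (λ x → t ∈ cover x) (e ∷ es) → t ∈ cover m
    ∈cover-m t∈all = argmin-all bound (All.head t∈all) (All.tail t∈all)
    <bound-m : ∀ {t} → t < bound m → All (λ x → t < bound x) (e ∷ es)
    <bound-m t<m = <-≤-trans t<m (f[argmin]≤f[⊤] {f = bound} e es) ∷ All.map (<-≤-trans t<m) (f[argmin]≤f[xs] {f = bound} e es)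

module _ {a} {A : Set a} where

  lookup-∷ʳ-inject₁ : ∀ {n} (xs : Vec A n) t i → lookup (xs ∷ʳ t) (inject₁ i) ≡ lookup xs i
  lookup-∷ʳ-inject₁ (x ∷ xs) t zero = refl
  lookup-∷ʳ-inject₁ (x ∷ xs) t (suc i) = lookup-∷ʳ-inject₁ xs t i

  lookup-∷ʳ-fromℕ : ∀ {n} (xs : Vec A n) t → lookup (xs ∷ʳ t) (fromℕ n) ≡ t
  lookup-∷ʳ-fromℕ [] t = refl
  lookup-∷ʳ-fromℕ (x ∷ xs) t = lookup-∷ʳ-fromℕ xs t

  init-∷ʳ-last : ∀ {n} (xs : Vec A (suc n)) → xs ≡ init xs ∷ʳ last xs
  init-∷ʳ-last xs = proj₂ (proj₂ (initLast xs))

tailAfter-inject₁-∷ʳ : ∀ {d} i (n : Point d) t → tailAfter (inject₁ i) (n ∷ʳ t) ≡ tailAfter i n ++ [ t ]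
tailAfter-inject₁-∷ʳ zero (x ∷ n) t = toList-∷ʳ t n
tailAfter-inject₁-∷ʳ (suc i) (x ∷ n) t = tailAfter-inject₁-∷ʳ i n t

tailAfter-fromℕ : ∀ {d} (n : Point (suc d)) → tailAfter (fromℕ d) n ≡ []
tailAfter-fromℕ {zero} (x ∷ []) = refl
tailAfter-fromℕ {suc d} (x ∷ n) = tailAfter-fromℕ n

∷ʳ-⪯-∷ʳ⁺ : ∀ {d} {p q : Point d} {s t} → p ⪯ q → s ≤ t → (p ∷ʳ s) ⪯ (q ∷ʳ t)
∷ʳ-⪯-∷ʳ⁺ {d} {p} {q} {s} {t} p⪯q s≤t j with view j
... | ‵fromℕ = subst₂ _≤_ (sym (lookup-∷ʳ-fromℕ p s)) (sym (lookup-∷ʳ-fromℕ q t)) s≤t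
... | ‵inject₁ i = subst₂ _≤_ (sym (lookup-∷ʳ-inject₁ p s i)) (sym (lookup-∷ʳ-inject₁ q t i)) (p⪯q i)

∷ʳ-⪯-∷ʳ⁻ : ∀ {d} (p q : Point d) {s t} → (p ∷ʳ s) ⪯ (q ∷ʳ t) → p ⪯ q × s ≤ t
∷ʳ-⪯-∷ʳ⁻ {d} p q {s} {t} ps⪯qt =
  (λ i → subst₂ _≤_ (lookup-∷ʳ-inject₁ p s i) (lookup-∷ʳ-inject₁ q t i) (ps⪯qt (inject₁ i))) ,
  subst₂ _≤_ (lookup-∷ʳ-fromℕ p s) (lookup-∷ʳ-fromℕ q t) (ps⪯qt (fromℕ d))

_⪯?_ : ∀ {d} (p q : Point d) → Dec (p ⪯ q)
p ⪯? q = allFin? (λ i → lookup p i ≤? lookup q i)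

∑□ : ∀ {d} → ℕ → (Point d → ℕ) → ℕ
∑□ {zero} M f = f []
∑□ {suc d} M f = ∑< M (λ t → ∑□ M (λ p → f (p ∷ʳ t)))

∑□-cong : ∀ {d} M {f g : Point d → ℕ} → (∀ p → f p ≡ g p) → ∑□ M f ≡ ∑□ M g
∑□-cong {zero} M f≗g = f≗g []
∑□-cong {suc d} M f≗g = ∑<-cong M (λ t → ∑□-cong M (λ p → f≗g (p ∷ʳ t)))

∑□-mono : ∀ {d} M {f g : Point d → ℕ} → (∀ p → f p ≤ g p) → ∑□ M f ≤ ∑□ M g
∑□-mono {zero} M f≤g = f≤g []
∑□-mono {suc d} M f≤g = ∑<-mono M (λ t → ∑□-mono M (λ p → f≤g (p ∷ʳ t)))

∑□-zero : ∀ {d} M → ∑□ {d} M (λ _ → 0) ≡ 0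
∑□-zero {zero} M = refl
∑□-zero {suc d} M = trans (∑<-cong M (λ t → ∑□-zero {d} M)) (∑<-zero M)

∑□-distrib-+ : ∀ {d} M (f g : Point d → ℕ) → ∑□ M (λ p → f p + g p) ≡ ∑□ M f + ∑□ M g
∑□-distrib-+ {zero} M f g = refl
∑□-distrib-+ {suc d} M f g =
  trans (∑<-cong M (λ t → ∑□-distrib-+ M (λ p → f (p ∷ʳ t)) (λ p → g (p ∷ʳ t)))) (∑<-distrib-+ M _ _)

∑□-∑<-comm : ∀ {d} M N (h : Point d → ℕ → ℕ) → ∑□ M (λ p → ∑< N (h p)) ≡ ∑< N (λ t → ∑□ M (λ p → h p t))
∑□-∑<-comm {zero} M N h = refl
∑□-∑<-comm {suc d} M N h = trans (∑<-cong M (λ s → ∑□-∑<-comm M N (λ p → h (p ∷ʳ s))))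
  (∑<-comm M N (λ s t → ∑□ M (λ p → h (p ∷ʳ s) t)))

count□ : ∀ {d} {P : Pred (Point d) ℓ} → ℕ → Decidable P → ℕ
count□ M P? = ∑□ M (λ p → χ (P? p))

count□-mono : ∀ {d ℓ′} {P : Pred (Point d) ℓ} {Q : Pred (Point d) ℓ′} M (P? : Decidable P) (Q? : Decidable Q) →
  P ⊆ Q → count□ M P? ≤ count□ M Q?
count□-mono M P? Q? P⊆Q = ∑□-mono M (λ p → χ-mono P⊆Q (P? p) (Q? p))

Boxed : ∀ {d} → ℕ → Point d → Set
Boxed M p = ∀ i → lookup p i < M

_≟ₚ_ : ∀ {d} → DecidableEquality (Point d)
_≟ₚ_ = ≡-dec _≟_

_∈ₚ?_ : ∀ {d} → Decidable₂ (_∈_ {A = Point d})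
p ∈ₚ? xs = any? (p ≟ₚ_) xs

count□-≟ : ∀ {d} M (x : Point d) → Boxed M x → count□ M (_≟ₚ x) ≡ 1
count□-≟ {zero} M [] _ = refl
count□-≟ {suc d} M x x∈□ with initLast x
... | ini , lst , refl =
  trans (∑<-cong M column) (count-≟≡1 M lst (subst (_< M) (lookup-∷ʳ-fromℕ ini lst) (x∈□ (fromℕ d))))
  where
  column : ∀ t → count□ M (λ p → (p ∷ʳ t) ≟ₚ (ini ∷ʳ lst)) ≡ χ (t ≟ lst)
  column t with t ≟ lst
  ... | yes refl = begin
    count□ M (λ p → (p ∷ʳ t) ≟ₚ (ini ∷ʳ t))
      ≡⟨ ∑□-cong M (λ p → χ-cong (proj₁ ∘ ∷ʳ-injective p ini) (cong (_∷ʳ t)) ((p ∷ʳ t) ≟ₚ (ini ∷ʳ t)) (p ≟ₚ ini)) ⟩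
    count□ M (_≟ₚ ini)
      ≡⟨ count□-≟ M ini (λ i → subst (_< M) (lookup-∷ʳ-inject₁ ini t i) (x∈□ (inject₁ i))) ⟩
    1
      ≡⟨ χ-yes refl (t ≟ t) ⟨
    χ (t ≟ t)
      ∎
    where open ≡-Reasoning
  ... | no t≢lst = begin
    count□ M (λ p → (p ∷ʳ t) ≟ₚ (ini ∷ʳ lst))
      ≡⟨ ∑□-cong M (λ p → χ-no (t≢lst ∘ proj₂ ∘ ∷ʳ-injective p ini) ((p ∷ʳ t) ≟ₚ (ini ∷ʳ lst))) ⟩
    ∑□ {d} M (λ _ → 0)
      ≡⟨ ∑□-zero {d} M ⟩
    0
      ≡⟨ χ-no t≢lst (t ≟ lst) ⟨
    χ (t ≟ lst)
      ∎
    where open ≡-Reasoning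

count□-∈ : ∀ {d} M (xs : List (Point d)) → Unique xs → All (Boxed M) xs → count□ M (_∈ₚ? xs) ≡ length xs
count□-∈ {d} M [] _ _ = ∑□-zero {d} M
count□-∈ M (x ∷ xs) (x∉xs ∷ xs!) (x∈□ ∷ xs∈□) = begin
  count□ M (_∈ₚ? (x ∷ xs))                     ≡⟨ ∑□-cong M (λ p → χ-any-∷-∉ _≟ₚ_ p (All¬⇒¬Any x∉xs)) ⟩
  ∑□ M (λ p → χ (p ≟ₚ x) + χ (p ∈ₚ? xs))        ≡⟨ ∑□-distrib-+ M (λ p → χ (p ≟ₚ x)) (λ p → χ (p ∈ₚ? xs)) ⟩
  count□ M (_≟ₚ x) + count□ M (_∈ₚ? xs)         ≡⟨ cong₂ _+_ (count□-≟ M x x∈□) (count□-∈ M xs xs! xs∈□) ⟩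
  suc (length xs)                              ∎
  where open ≡-Reasoning

Boxed-mono : ∀ {d} {M N} {p : Point d} → M ≤ N → Boxed M p → Boxed N p
Boxed-mono M≤N p∈□ i = <-≤-trans (p∈□ i) M≤N

boxed-point : ∀ {d} (p : Point d) → ∃[ M ] Boxed M p
boxed-point [] = 0 , λ ()
boxed-point (x ∷ p) with boxed-point p
... | M , p∈□ = suc x ⊔ M , λ { zero → m≤m⊔n (suc x) M ; (suc i) → Boxed-mono {p = p} (m≤n⊔m (suc x) M) p∈□ i }

boxed-list : ∀ {d} (xs : List (Point d)) → ∃[ M ] All (Boxed M) xs
boxed-list [] = 0 , []
boxed-list (x ∷ xs) with boxed-point x | boxed-list xs
... | M , x∈□ | N , xs∈□ =
  M ⊔ N , Boxed-mono {p = x} (m≤m⊔n M N) x∈□ ∷ All.map (λ {p} → Boxed-mono {p = p} (m≤n⊔m M N)) xs∈□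

Hits : ∀ {d} → Family → Point d → Fin d → Set
Hits R n j = R (tailAfter j n) (lookup n j)

Avoids : ∀ {d} → Family → Point d → Set
Avoids R n = ∀ j → ¬ Hits R n j

-- The family of the slice n_d = t: (R ↾ t) (n_{l+1} ∷ … ∷ n_{d-1} ∷ []) = R_{l; n_{l+1}, …, n_{d-1}, t}.
_↾_ : Family → ℕ → Family
(R ↾ t) ys = R (ys ++ [ t ])

Hits-∷ʳ : ∀ {d} R (n : Point d) t j → Hits R (n ∷ʳ t) j → R [] t ⊎ ∃[ i ] (j ≡ inject₁ i × Hits (R ↾ t) n i)
Hits-∷ʳ R n t j hit with view j
... | ‵fromℕ = inj₁ (subst₂ R (tailAfter-fromℕ (n ∷ʳ t)) (lookup-∷ʳ-fromℕ n t) hit)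
... | ‵inject₁ i = inj₂ (i , refl , subst₂ R (tailAfter-inject₁-∷ʳ i n t) (lookup-∷ʳ-inject₁ n t i) hit)

avoids-∷ʳ : ∀ {d} R (n : Point d) {t} → ¬ R [] t → Avoids (R ↾ t) n → Avoids R (n ∷ʳ t)
avoids-∷ʳ R n {t} ¬Rt avoids j hit with Hits-∷ʳ R n t j hit
... | inj₁ Rt = ¬Rt Rt
... | inj₂ (i , _ , hit′) = avoids i hit′

avoidsAbove-∷ʳ : ∀ {d} R (n : Point d) {t i} → ¬ R [] t → AvoidsAbove (R ↾ t) i n → AvoidsAbove R (inject₁ i) (n ∷ʳ t)
avoidsAbove-∷ʳ R n {t} {i} ¬Rt avoids j i<j hit with Hits-∷ʳ R n t j hit
... | inj₁ Rt = ¬Rt Rt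
... | inj₂ (j′ , refl , hit′) = avoids j′ (subst₂ _<_ (toℕ-inject₁ i) (toℕ-inject₁ j′) i<j) hit′

bounded-↾ : ∀ {d} {b : Point d} {s} R {t} → ¬ R [] t → Prop1 (b ∷ʳ s) R → Prop1 b (R ↾ t)
bounded-↾ {b = b} {s} R {t} ¬Rt bounded i n avoids =
  subst₂ CardLe (cong R (tailAfter-inject₁-∷ʳ i n t)) (lookup-∷ʳ-inject₁ b s i)
    (bounded (inject₁ i) (n ∷ʳ t) (avoidsAbove-∷ʳ R n ¬Rt avoids))

top-bounded : ∀ {d} {b : Point d} {s} R → Prop1 (b ∷ʳ s) R → CardLe (R []) s
top-bounded {d} {b} {s} R bounded =
  subst₂ CardLe (cong R (tailAfter-fromℕ (b ∷ʳ s))) (lookup-∷ʳ-fromℕ b s)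
    (bounded (fromℕ d) (b ∷ʳ s) (λ j d<j → contradiction (≤fromℕ j) (<⇒≱ d<j)))

-- A point b of B with its sets R_{l; …; b}: `bounded` is (1), and `catches` is the consequence
-- of (2) that is inherited by the slices.
record Generator {d} (A : Pred (Point d) 0ℓ) : Set₁ where
  field
    point : Point d
    family : Family
    bounded : Prop1 point family
    catches : ∀ {a} → A a → ¬ Avoids family a

open Generator

↑ᴳ : ∀ {d} {A : Pred (Point d) 0ℓ} → List (Generator A) → Pred (Point d) (lsuc 0ℓ)
↑ᴳ gs p = Any (λ g → point g ⪯ p) gs

↑ᴳ? : ∀ {d} {A : Pred (Point d) 0ℓ} (gs : List (Generator A)) → Decidable (↑ᴳ gs)
↑ᴳ? gs p = any? (λ g → point g ⪯? p) gs

module _ {d} {A : Pred (Point (suc d)) 0ℓ} (g : Generator A) where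

  base : Point d
  base = init (point g)

  height : ℕ
  height = last (point g)

  point⪯∷ʳ⁻ : ∀ {p t} → point g ⪯ (p ∷ʳ t) → base ⪯ p × height ≤ t
  point⪯∷ʳ⁻ {p} {t} = ∷ʳ-⪯-∷ʳ⁻ base p ∘ subst (_⪯ (p ∷ʳ t)) (init-∷ʳ-last (point g))

  private
    bounded′ : Prop1 (base ∷ʳ height) (family g)
    bounded′ = subst (λ b → Prop1 b (family g)) (init-∷ʳ-last (point g)) (bounded g)

    top : CardLe (family g []) height
    top = top-bounded {b = base} (family g) bounded′

  -- A list containing R_{d;b}.
  cover : List ℕ
  cover = proj₁ top

  cover≤height : length cover ≤ height
  cover≤height = proj₁ (proj₂ top)

  restrict : ∀ t → t ∉ cover → Generator (λ p → A (p ∷ʳ t))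
  restrict t t∉cover = record
    { point = base
    ; family = family g ↾ t
    ; bounded = bounded-↾ {b = base} (family g) ¬Rt bounded′
    ; catches = λ {a} a∈A avoids → catches g a∈A (avoids-∷ʳ (family g) a ¬Rt avoids)
    }
    where
    ¬Rt : ¬ family g [] t
    ¬Rt Rt = t∉cover (proj₂ (proj₂ top) t Rt)

restrictAll : ∀ {d} {A : Pred (Point (suc d)) 0ℓ} t → List (Generator A) → List (Generator (λ p → A (p ∷ʳ t)))
restrictAll t [] = []
restrictAll t (g ∷ gs) with t ∈? cover g
... | yes _ = restrictAll t gs
... | no t∉cover = restrict g t t∉cover ∷ restrictAll t gs

∉↑ᴳ-restrictAll : ∀ {d} {A : Pred (Point (suc d)) 0ℓ} t (gs : List (Generator A)) p →
  ¬ ↑ᴳ (restrictAll t gs) p → All (λ g → base g ⪯ p → t ∈ cover g) gs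
∉↑ᴳ-restrictAll t [] p _ = []
∉↑ᴳ-restrictAll t (g ∷ gs) p p∉↑ with t ∈? cover g
... | yes t∈cover = (λ _ → t∈cover) ∷ ∉↑ᴳ-restrictAll t gs p p∉↑
... | no _ = (λ base⪯p → contradiction (here base⪯p) p∉↑) ∷ ∉↑ᴳ-restrictAll t gs p (p∉↑ ∘ there)

IsDownClosed : ∀ {d} → Pred (Point d) 0ℓ → Set
IsDownClosed D = ∀ {p q} → p ⪯ q → D q → D p

module _ {d} {D A : Pred (Point (suc d)) 0ℓ} (D? : Decidable D) (D-down : IsDownClosed D)
         (gs : List (Generator A)) (M : ℕ) (p : Point d) where

  private
    C? : Decidable (λ t → D (p ∷ʳ t))
    C? t = D? (p ∷ʳ t)

    below : List (Generator A)
    below = filter (λ g → base g ⪯? p) gs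

  count-∉↑restrictAll≤count-∉↑ :
    count M (λ t → C? t ×-dec ¬? (↑ᴳ? (restrictAll t gs) p)) ≤ count M (λ t → C? t ×-dec ¬? (↑ᴳ? gs (p ∷ʳ t)))
  count-∉↑restrictAll≤count-∉↑ = begin
    count M (λ t → C? t ×-dec ¬? (↑ᴳ? (restrictAll t gs) p))
      ≤⟨ count-mono M (λ t → C? t ×-dec ¬? (↑ᴳ? (restrictAll t gs) p))
                      (C? ∩? (λ t → all? (λ g → t ∈? cover g) below)) covered ⟩
    count M (C? ∩? (λ t → all? (λ g → t ∈? cover g) below))
      ≤⟨ Column.count-All∈≤count-All< C? (λ s≤t → D-down (∷ʳ-⪯-∷ʳ⁺ {p = p} {q = p} (λ _ → ≤-refl) s≤t))
                                       M cover height cover≤height below ⟩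
    count M (C? ∩? (λ t → all? (λ g → t <? height g) below))
      ≤⟨ count-mono M (C? ∩? (λ t → all? (λ g → t <? height g) below))
                      (λ t → C? t ×-dec ¬? (↑ᴳ? gs (p ∷ʳ t))) uncovered ⟩
    count M (λ t → C? t ×-dec ¬? (↑ᴳ? gs (p ∷ʳ t))) ∎
    where
    open ≤-Reasoning
    covered : ∀ {t} → D (p ∷ʳ t) × ¬ ↑ᴳ (restrictAll t gs) p → D (p ∷ʳ t) × All (λ g → t ∈ cover g) below
    covered {t} (dt , p∉↑) = dt , All.tabulate λ g∈below →
      let g∈gs , base⪯p = ∈-filter⁻ (λ g → base g ⪯? p) g∈below
      in All.lookup (∉↑ᴳ-restrictAll t gs p p∉↑) g∈gs base⪯p
    uncovered : ∀ {t} → D (p ∷ʳ t) × All (λ g → t < height g) below → D (p ∷ʳ t) × ¬ ↑ᴳ gs (p ∷ʳ t)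
    uncovered {t} (dt , t<heights) = dt , λ p∈↑ →
      let g , g∈gs , g⪯ = find p∈↑
          base⪯p , height≤t = point⪯∷ʳ⁻ g {p} g⪯
      in <⇒≱ (All.lookup t<heights (∈-filter⁺ (λ g → base g ⪯? p) g∈gs base⪯p)) height≤t

count-A≤count-D∖↑ᴳ : ∀ {d} M {D A : Pred (Point d) 0ℓ} (D? : Decidable D) (A? : Decidable A) →
  IsDownClosed D → A ⊆ D → (gs : List (Generator A)) → count□ M A? ≤ count□ M (D? ∩? ∁? (↑ᴳ? gs))
count-A≤count-D∖↑ᴳ {zero} M D? A? D-down A⊆D gs =
  χ-mono (λ a → A⊆D a , λ p∈↑ → catches (proj₁ (satisfied p∈↑)) a (λ ())) (A? []) ((D? ∩? ∁? (↑ᴳ? gs)) [])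
count-A≤count-D∖↑ᴳ {suc d} M D? A? D-down A⊆D gs = begin
  count□ M A?
    ≤⟨ ∑<-mono M (λ t → count-A≤count-D∖↑ᴳ M (λ p → D? (p ∷ʳ t)) (λ p → A? (p ∷ʳ t))
                          (λ {p} {q} p⪯q → D-down (∷ʳ-⪯-∷ʳ⁺ {p = p} {q = q} p⪯q ≤-refl)) A⊆D (restrictAll t gs)) ⟩
  ∑< M (λ t → count□ M (λ p → D? (p ∷ʳ t) ×-dec ¬? (↑ᴳ? (restrictAll t gs) p)))
    ≡⟨ ∑□-∑<-comm M M (λ p t → χ (D? (p ∷ʳ t) ×-dec ¬? (↑ᴳ? (restrictAll t gs) p))) ⟨
  ∑□ M (λ p → count M (λ t → D? (p ∷ʳ t) ×-dec ¬? (↑ᴳ? (restrictAll t gs) p)))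
    ≤⟨ ∑□-mono M (count-∉↑restrictAll≤count-∉↑ D? D-down gs M) ⟩
  ∑□ M (λ p → count M (λ t → D? (p ∷ʳ t) ×-dec ¬? (↑ᴳ? gs (p ∷ʳ t))))
    ≡⟨ ∑□-∑<-comm M M (λ p t → χ (D? (p ∷ʳ t) ×-dec ¬? (↑ᴳ? gs (p ∷ʳ t)))) ⟩
  count□ M (D? ∩? ∁? (↑ᴳ? gs)) ∎
  where open ≤-Reasoning

toGenerator : ∀ {k} {A : List (Point (suc k))} b → Σ Family (λ R → Prop1 b R × Prop2 A b R zero) → Generator (_∈ A)
toGenerator b (R , R-bounded , R-hits) = record
  { point = b
  ; family = R
  ; bounded = R-bounded
  ; catches = λ {a} a∈A avoids → avoids zero (R-hits a a∈A (λ j _ → avoids j))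
  }

module _ {k} {A : List (Point (suc k))} {B : Pred (Point (suc k)) 0ℓ}
         (generate : ∀ b → B b → Σ Family λ R → Prop1 b R × Prop2 A b R zero) where

  generators : (xs : List (Point (suc k))) → All (Dec ∘ B) xs → List (Generator (_∈ A))
  generators [] [] = []
  generators (x ∷ xs) (yes x∈B ∷ B?s) = toGenerator x (generate x x∈B) ∷ generators xs B?s
  generators (x ∷ xs) (no _ ∷ B?s) = generators xs B?s

  generators-complete : ∀ {xs} (B?s : All (Dec ∘ B) xs) {b} → b ∈ xs → B b → Any (λ g → point g ≡ b) (generators xs B?s)
  generators-complete (yes _ ∷ _) (here refl) _ = here refl
  generators-complete (no b∉B ∷ _) (here refl) b∈B = contradiction b∈B b∉B
  generators-complete (yes _ ∷ B?s) (there b∈xs) b∈B = there (generators-complete B?s b∈xs b∈B)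
  generators-complete (no _ ∷ B?s) (there b∈xs) b∈B = generators-complete B?s b∈xs b∈B

¬¬-decide-all : ∀ {a} {X : Set a} {P : Pred X a} (xs : List X) → ¬ ¬ All (Dec ∘ P) xs
¬¬-decide-all {a} xs = All.sequenceA a (RawMonad.rawApplicative ¬¬-Monad) (All.tabulate (λ _ → ¬¬-excluded-middle))

lemma4p7 : (k : ℕ) → let d = suc k in
    (D A : List (Point d)) → (B : Point d → Set) →
    Unique D → IsDownSet D →
    Unique A → (∀ a → a ∈ A → a ∈ D) →
    (∀ b → B b → Σ Family λ R → Prop1 b R × Prop2 A b R zero) →
    (L : List (Point d)) → Unique L → (∀ p → p ∈ L ⇔ (p ∈ D × ¬ ↑ B p)) →
    length A ≤ length L
lemma4p7 k D A B _ D-down A! A⊆D generate L L! L≡D∖↑B =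
  -- B itself need not be decidable, but the goal is, so B may be decided on the points of D.
  decidable-stable (length A ≤? length L) (¬¬-map count-bound (¬¬-decide-all D))
  where
  M : ℕ
  M = proj₁ (boxed-list D)
  boxed : ∀ {xs} → (∀ x → x ∈ xs → x ∈ D) → All (Boxed M) xs
  boxed xs⊆D = All.tabulate (λ x∈xs → All.lookup (proj₂ (boxed-list D)) (xs⊆D _ x∈xs))
  count-bound : All (Dec ∘ B) D → length A ≤ length L
  count-bound B?s = begin
    length A                          ≡⟨ count□-∈ M A A! (boxed A⊆D) ⟨
    count□ M (_∈ₚ? A)                 ≤⟨ count-A≤count-D∖↑ᴳ M (_∈ₚ? D) (_∈ₚ? A) (D-down _ _) (A⊆D _) gs ⟩
    count□ M (_∈ₚ? D ∩? ∁? (↑ᴳ? gs))  ≤⟨ count□-mono M (_∈ₚ? D ∩? ∁? (↑ᴳ? gs)) (_∈ₚ? L) ∉↑ᴳ⇒∈L ⟩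
    count□ M (_∈ₚ? L)                 ≡⟨ count□-∈ M L L! (boxed (λ p p∈L → proj₁ (Equivalence.to (L≡D∖↑B p) p∈L))) ⟩
    length L                          ∎
    where
    open ≤-Reasoning
    gs : List (Generator (_∈ A))
    gs = generators generate D B?s
    ∉↑ᴳ⇒∈L : ∀ {p} → p ∈ D × ¬ ↑ᴳ gs p → p ∈ L
    ∉↑ᴳ⇒∈L {p} (p∈D , p∉↑) = Equivalence.from (L≡D∖↑B p)
      (p∈D , λ (b , b∈B , b⪯p) →
        p∉↑ (Any.map (λ { refl → b⪯p }) (generators-complete generate B?s (D-down b p b⪯p p∈D) b∈B)))
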